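{- Let $D$ be a finite set, $r\in\mathbb{N}$, $R\subseteq D^r$ and $\overline{R}:=D^r\setminus R$. For all $n\in\mathbb{N}$ and $\varepsilon\in(0,1)$, $\operatorname{SPR}(R,n,\varepsilon)\ge\operatorname{NRD}(\overline{R},n)$.
   Context: An instance $(X,Y)$ of $\operatorname{CSP}(P)$, $P\subseteq D^r$, has finite variable set $X$ and clauses $Y\subseteq X^r$; an assignment $\sigma:X\to D$ satisfies $y$ if $\sigma(y):=(\sigma(y_1),\dots,\sigma(y_r))\in P$. It is non-redundant if for each $y\in Y$ there is $\sigma_y$ with $\sigma_y(y)\notin P$ and $\sigma_y(y')\in P$ for all $y'\ne y$ in $Y$; $\operatorname{NRD}(P,n)$ is the maximum $|Y|$ of a non-redundant instance with $n$ variables. A map $w:Y\to\mathbb{R}_{\ge0}$ is an $\varepsilon$-sparsifier of an instance of $\operatorname{CSP}(R)$ if for every $\sigma$, $\sum_yw(y)\mathbf 1[\sigma(y)\in R]$ is between $(1-\varepsilon)$ and $(1+\varepsilon)$ times the number of clauses $y$ with $\sigma(y)\in R$; $\operatorname{SPR}(R,n,\varepsilon)$ is the maximum over $n$-variable instances of the minimum support size of an $\varepsilon$-sparsifier.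
   Formalization: The parameter ε ranges over the rationals in (0,1), and the weights of ε-sparsifiers take values in the nonnegative rationals instead of $\mathbb{R}_{\ge0}$. -}

module Defs where

open import Data.Nat as ℕ using (ℕ; zero; suc)
open import Data.Bool using (Bool; true; false; not; if_then_else_)
open import Data.Fin using (Fin; zero; suc)
open import Data.Vec using (Vec; map)
open import Data.List using (List; length; lookup)
open import Data.List.Relation.Unary.Unique.Propositional using (Unique)
open import Data.Rational using (ℚ; 0ℚ; 1ℚ; _+_; _-_; _*_; _≤_)
open import Data.Rational.Properties using (_≟_)
open import Data.Product using (Σ; _×_; ∃)
open import Relation.Nullary using (¬_; does)
open import Relation.Binary.PropositionalEquality using (_≡_)

-- The domain D is Fin d. A relation P ⊆ D^r is a decidable (Boolean) predicate on r-tuples.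
Rel : ℕ → ℕ → Set
Rel d r = Vec (Fin d) r → Bool

compl : ∀ {d r} → Rel d r → Rel d r
compl R t = not (R t)

-- An instance of CSP(P) on variable set X = Fin n: a finite SET Y ⊆ X^r of clauses,
-- represented as a duplicate-free list.
record Instance (n r : ℕ) : Set where
  constructor inst
  field
    clauses : List (Vec (Fin n) r)
    unique  : Unique clauses
open Instance public

size : ∀ {n r} → Instance n r → ℕ
size I = length (clauses I)

Idx : ∀ {n r} → Instance n r → Set
Idx I = Fin (size I)

clause : ∀ {n r} (I : Instance n r) → Idx I → Vec (Fin n) r
clause I i = lookup (clauses I) i

apply : ∀ {n d r} → (Fin n → Fin d) → Vec (Fin n) r → Vec (Fin d) r
apply σ y = map σ y

NonRedundant : ∀ {n d r} → Rel d r → Instance n r → Set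
NonRedundant {n} {d} P I =
  (i : Idx I) → Σ (Fin n → Fin d) λ σ →
    (P (apply σ (clause I i)) ≡ false) ×
    ((j : Idx I) → ¬ (j ≡ i) → P (apply σ (clause I j)) ≡ true)

sumℚ : ∀ {m} → (Fin m → ℚ) → ℚ
sumℚ {zero}  f = 0ℚ
sumℚ {suc m} f = f zero + sumℚ (λ i → f (suc i))

count : ∀ {m} → (Fin m → Bool) → ℕ
count {zero}  b = 0
count {suc m} b = (if b zero then 1 else 0) ℕ.+ count (λ i → b (suc i))

indicator : Bool → ℚ
indicator true  = 1ℚ
indicator false = 0ℚ

satCount : ∀ {n d r} → Rel d r → (I : Instance n r) → (Fin n → Fin d) → ℚ
satCount R I σ = sumℚ (λ i → indicator (R (apply σ (clause I i))))

weightedSat : ∀ {n d r} → Rel d r → (I : Instance n r) → (Idx I → ℚ) → (Fin n → Fin d) → ℚ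
weightedSat R I w σ = sumℚ (λ i → w i * indicator (R (apply σ (clause I i))))

Sparsifier : ∀ {n d r} → Rel d r → ℚ → (I : Instance n r) → (Idx I → ℚ) → Set
Sparsifier {n} {d} R ε I w =
  ((i : Idx I) → 0ℚ ≤ w i) ×
  ((σ : Fin n → Fin d) →
     ((1ℚ - ε) * satCount R I σ ≤ weightedSat R I w σ) ×
     (weightedSat R I w σ ≤ (1ℚ + ε) * satCount R I σ))

support : ∀ {n r} (I : Instance n r) → (Idx I → ℚ) → ℕ
support I w = count (λ i → not (does (w i ≟ 0ℚ)))

-- "k ≤ NRD(P,n)": some non-redundant n-variable instance of CSP(P) has ≥ k clauses
NRD-atLeast : ∀ {d r} → Rel d r → ℕ → ℕ → Set
NRD-atLeast {d} {r} P n k =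
  Σ (Instance n r) λ I → NonRedundant P I × (k ℕ.≤ size I)

-- "k ≤ SPR(R,n,ε)": some n-variable instance of CSP(R) whose every ε-sparsifier
-- has support size ≥ k (i.e. its minimum support size is ≥ k)
SPR-atLeast : ∀ {d r} → Rel d r → ℕ → ℚ → ℕ → Set
SPR-atLeast {d} {r} R n ε k =
  Σ (Instance n r) λ I → (w : Idx I → ℚ) → Sparsifier R ε I w → k ℕ.≤ support I w

{-# OPTIONS --safe #-}
module Submission where

-- Let Y be a non-redundant instance of CSP(D^r \ R). For each clause y, the witness σ_y of
-- non-redundancy violates y in D^r \ R and satisfies every other clause there; read
-- against R, σ_y satisfies y and nothing else. So for any ε-sparsifier w of Y as an
-- instance of CSP(R), evaluating at σ_y gives (1 - ε) · 1 ≤ w(y), whence w(y) > 0 as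
-- ε < 1. Hence every clause lies in the support and the support has size |Y|.

open import Defs
open import Data.Nat using (ℕ)
open import Data.Rational using (ℚ; 0ℚ; 1ℚ; _<_; _≤_; _-_; _*_; -_)
import Data.Nat as ℕ
open import Data.Fin using (Fin; zero; suc)
open import Data.Fin.Properties using (suc-injective)
open import Data.Bool using (Bool; true; false; not)
open import Data.Bool.Properties using (not-injective)
open import Data.Product using (∃; _×_; _,_; proj₁)
open import Data.Rational.Properties
  using (_≟_; +-identityˡ; +-identityʳ; +-inverseʳ; +-mono-<-≤; *-identityʳ; *-zeroʳ;
         ≤-refl; <-≤-trans; <⇒≢)
open import Function using (_∘_)
open import Relation.Nullary.Decidable using (dec-false)
open import Relation.Binary.PropositionalEquality

count-all-true : ∀ {m} (b : Fin m → Bool) → (∀ i → b i ≡ true) → count b ≡ m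
count-all-true {ℕ.zero}  b all-true = refl
count-all-true {ℕ.suc m} b all-true rewrite all-true zero =
  cong ℕ.suc (count-all-true (λ i → b (suc i)) (λ i → all-true (suc i)))

sumℚ-zero : ∀ {m} (f : Fin m → ℚ) → (∀ j → f j ≡ 0ℚ) → sumℚ f ≡ 0ℚ
sumℚ-zero {ℕ.zero}  f f≡0 = refl
sumℚ-zero {ℕ.suc m} f f≡0
  rewrite f≡0 zero | sumℚ-zero (λ j → f (suc j)) (λ j → f≡0 (suc j)) = refl

sumℚ-single : ∀ {m} (f : Fin m → ℚ) (i : Fin m) → (∀ j → j ≢ i → f j ≡ 0ℚ) → sumℚ f ≡ f i
sumℚ-single {ℕ.suc m} f zero f≡0
  rewrite sumℚ-zero (λ j → f (suc j)) (λ j → f≡0 (suc j) λ ()) = +-identityʳ (f zero)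
sumℚ-single {ℕ.suc m} f (suc i) f≡0
  rewrite f≡0 zero (λ ())
        | sumℚ-single (λ j → f (suc j)) i (λ j j≢i → f≡0 (suc j) (j≢i ∘ suc-injective))
  = +-identityˡ (f (suc i))

p<q⇒0<q-p : ∀ {p q} → p < q → 0ℚ < q - p
p<q⇒0<q-p {p} {q} p<q = subst (_< q - p) (+-inverseʳ p) (+-mono-<-≤ p<q (≤-refl { - p}))

support-full : ∀ {n r} (I : Instance n r) (w : Idx I → ℚ) → (∀ i → w i ≢ 0ℚ) →
  support I w ≡ size I
support-full I w w≢0 = count-all-true _ (λ i → cong not (dec-false (w i ≟ 0ℚ) (w≢0 i)))

module _ {n d r} (R : Rel d r) (I : Instance n r) where

  Isolates : (Fin n → Fin d) → Idx I → Set
  Isolates σ i = (R (apply σ (clause I i)) ≡ true) ×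
                 (∀ j → j ≢ i → R (apply σ (clause I j)) ≡ false)

  nonRedundant-compl⇒isolating : NonRedundant (compl R) I → ∀ i → ∃ λ σ → Isolates σ i
  nonRedundant-compl⇒isolating nonRed i with nonRed i
  ... | σ , violated , satisfied =
    σ , not-injective violated , λ j j≢i → not-injective (satisfied j j≢i)

  satCount-isolating : ∀ {σ i} → Isolates σ i → satCount R I σ ≡ 1ℚ
  satCount-isolating {i = i} (Rᵢ , Rⱼ) =
    trans (sumℚ-single _ i (λ j j≢i → cong indicator (Rⱼ j j≢i))) (cong indicator Rᵢ)

  weightedSat-isolating : ∀ {σ i} (w : Idx I → ℚ) → Isolates σ i → weightedSat R I w σ ≡ w i
  weightedSat-isolating {σ} {i} w (Rᵢ , Rⱼ) = begin
    weightedSat R I w σ                        ≡⟨ sumℚ-single _ i vanishes ⟩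
    w i * indicator (R (apply σ (clause I i))) ≡⟨ cong (λ b → w i * indicator b) Rᵢ ⟩
    w i * 1ℚ                                   ≡⟨ *-identityʳ (w i) ⟩
    w i                                        ∎
    where
    open ≡-Reasoning
    vanishes : ∀ j → j ≢ i → w j * indicator (R (apply σ (clause I j))) ≡ 0ℚ
    vanishes j j≢i = trans (cong (λ b → w j * indicator b) (Rⱼ j j≢i)) (*-zeroʳ (w j))

  sparsifier-weight-isolated : ∀ {ε w σ i} → Sparsifier R ε I w → Isolates σ i → 1ℚ - ε ≤ w i
  sparsifier-weight-isolated {ε} {w} {σ} (_ , bounds) isolates =
    subst₂ _≤_ (trans (cong ((1ℚ - ε) *_) (satCount-isolating isolates)) (*-identityʳ _))
               (weightedSat-isolating w isolates)
               (proj₁ (bounds σ))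

  sparsifier-weight-positive : ∀ {ε w} → ε < 1ℚ → NonRedundant (compl R) I →
    Sparsifier R ε I w → ∀ i → 0ℚ < w i
  sparsifier-weight-positive {ε} ε<1 nonRed sparsifier i =
    let σ , isolates = nonRedundant-compl⇒isolating nonRed i in
    <-≤-trans (p<q⇒0<q-p ε<1) (sparsifier-weight-isolated {ε} sparsifier isolates)

proposition2p5 : (d r : ℕ) (R : Rel d r) (n : ℕ) (ε : ℚ) → 0ℚ < ε → ε < 1ℚ →
    (k : ℕ) → NRD-atLeast (compl R) n k → SPR-atLeast R n ε k
proposition2p5 d r R n ε _ ε<1 k (I , nonRed , k≤|I|) = I , support≥k
  where
  support≥k : (w : Idx I → ℚ) → Sparsifier R ε I w → k ℕ.≤ support I w
  support≥k w sparsifier = subst (k ℕ.≤_) (sym (support-full I w w≢0)) k≤|I|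
    where
    w≢0 : ∀ i → w i ≢ 0ℚ
    w≢0 i = ≢-sym (<⇒≢ (sparsifier-weight-positive R I ε<1 nonRed sparsifier i))
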